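{- Let $n\ge 1$ and let $A$ be a real $n\times n$ matrix. Then $\operatorname{dih}(A^T)=\operatorname{dih}(A)$, where $\operatorname{dih}$ denotes the dihedrant defined in the context.
   Context: For $n\ge1$ and $k=1,\dots,n$, let $\rho_k$ be the permutation of $\{1,\dots,n\}$ with $\rho_k(1)=k,\rho_k(2)=k+1,\dots,\rho_k(n-k+1)=n,\rho_k(n-k+2)=1,\dots,\rho_k(n)=k-1$ (the "rotations"), and let $\mu_k$ be the permutation with $\mu_k(1)=k,\mu_k(2)=k-1,\dots,\mu_k(k)=1,\mu_k(k+1)=n,\mu_k(k+2)=n-1,\dots,\mu_k(n)=k+1$ (the "reflections"). The set $D_n=\{\rho_k,\mu_k: k=1,\dots,n\}$ is the dihedral group, viewed as a set of permutations. Define $\operatorname{sig}(\rho_k)=1$ and $\operatorname{sig}(\mu_k)=-1$. For an $n\times n$ matrix $A=(a_{i,j})$, the dihedrant is $$\operatorname{dih}(A)=\sum_{k=1}^n\prod_{i=1}^n a_{i,\rho_k(i)}-\sum_{k=1}^n\prod_{i=1}^n a_{i,\mu_k(i)}.$$ (The sums run over the indices $k=1,\dots,n$, so for $n\le 2$ coinciding permutations are counted separately.) -}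

module Defs where

open import Level using (Level)
import Data.Nat as ℕ
open ℕ using (ℕ; zero; suc)
open import Data.Nat.DivMod using (_mod_)
open import Data.Fin using (Fin; zero; suc; toℕ)
open import Algebra.Bundles using (CommutativeRing)

-- Indices are 0-based: Fin (suc m) = {0,…,n-1} with n = suc m stands for the
-- paper's {1,…,n}; paper index p corresponds to Fin index p-1.

ρ : ∀ {m} → Fin (suc m) → Fin (suc m) → Fin (suc m)
ρ {m} k i = (toℕ i ℕ.+ toℕ k) mod (suc m)

-- reflection μ_{k+1} (0-based k):  i ↦ (k - i) mod n = (k + n - i) mod n
--   (i ≤ k gives k - i; i > k gives n + k - i, matching the paper)
μ : ∀ {m} → Fin (suc m) → Fin (suc m) → Fin (suc m)
μ {m} k i = ((toℕ k ℕ.+ suc m) ℕ.∸ toℕ i) mod (suc m)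

module _ {c ℓ} (R : CommutativeRing c ℓ) where
  open CommutativeRing R using (Carrier; _+_; _*_; -_; _-_; 0#; 1#)

  Σ[_] : ∀ n → (Fin n → Carrier) → Carrier
  Σ[ zero ] f = 0#
  Σ[ suc n ] f = f zero + Σ[ n ] (λ i → f (suc i))

  Π[_] : ∀ n → (Fin n → Carrier) → Carrier
  Π[ zero ] f = 1#
  Π[ suc n ] f = f zero * Π[ n ] (λ i → f (suc i))

  Matrix : ℕ → Set c
  Matrix n = Fin n → Fin n → Carrier

  transpose : ∀ {n} → Matrix n → Matrix n
  transpose A i j = A j i

  dih : ∀ {m} → Matrix (suc m) → Carrier
  dih {m} A =
    Σ[ suc m ] (λ k → Π[ suc m ] (λ i → A i (ρ k i)))
    - Σ[ suc m ] (λ k → Π[ suc m ] (λ i → A i (μ k i)))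

module Submission where

-- For a permutation σ, reindexing the product by i = σ⁻¹ j gives
--   Π_i A (σ i) i = Π_j A j (σ⁻¹ j),
-- so the product of Aᵀ along σ is the product of A along σ⁻¹.  Both halves
-- of the dihedrant run over a family of permutations closed under inversion:
-- ρ_k⁻¹ = ρ_{-k} (with -k = μ₀ k = (n - k) mod n, itself an involution) and
-- μ_k⁻¹ = μ_k.  Summing over such a family and reindexing the outer sum by
-- the corresponding bijection of the index set (k ↦ -k, resp. k ↦ k) turns
-- the rotation (resp. reflection) sum of Aᵀ into that of A.

open import Defs
open import Algebra.Bundles using (CommutativeRing)
open import Data.Nat using (ℕ; zero; suc; _+_; _*_; _∸_; _%_; _/_; _≤_; NonZero)
open import Data.Nat.Properties
  using (m∸n+n≡m; +-∸-assoc; m+n∸m≡n; m+[n∸m]≡n; m∸[m∸n]≡n; m∸n≤m; +-assoc; <⇒≤; ≤-trans; m≤n+m)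
open import Data.Nat.DivMod
  using (_mod_; m%n<n; m%n≤m; m≡m%n+[m/n]*n; [m+kn]%n≡m%n; [m+n]%n≡m%n; %-distribˡ-+; m<n⇒m%n≡m)
open import Data.Fin using (Fin; zero; suc; toℕ)
open import Data.Fin.Properties using (toℕ-injective; toℕ-fromℕ<; toℕ<n)
open import Data.Fin.Permutation using (Permutation; permutation; _⟨$⟩ʳ_; _⟨$⟩ˡ_; inverseˡ)
import Data.Fin.Permutation as Perm
import Algebra.Properties.CommutativeMonoid.Sum as MonoidSum
open import Relation.Binary.PropositionalEquality using (_≡_; refl; cong; cong₂; module ≡-Reasoning)
import Relation.Binary.PropositionalEquality as ≡

toℕ-mod : ∀ a n .{{_ : NonZero n}} → toℕ (a mod n) ≡ a % n
toℕ-mod a n = toℕ-fromℕ< (m%n<n a n)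

-- Subtracting b % n instead of b does not change the remainder, since the two
-- differ by a multiple of n.
[a∸b%n]%n≡[a∸b]%n : ∀ a b n .{{_ : NonZero n}} → b ≤ a → (a ∸ b % n) % n ≡ (a ∸ b) % n
[a∸b%n]%n≡[a∸b]%n a b n b≤a = begin
  (a ∸ b % n) % n                 ≡⟨ cong (λ x → (x ∸ b % n) % n) (≡.sym (m∸n+n≡m b≤a)) ⟩
  ((a ∸ b) + b ∸ b % n) % n       ≡⟨ cong (_% n) (+-∸-assoc (a ∸ b) (m%n≤m b n)) ⟩
  ((a ∸ b) + (b ∸ b % n)) % n     ≡⟨ cong (λ x → ((a ∸ b) + x) % n) b∸b%n≡[b/n]*n ⟩
  ((a ∸ b) + (b / n) * n) % n     ≡⟨ [m+kn]%n≡m%n (a ∸ b) (b / n) n ⟩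
  (a ∸ b) % n                     ∎
  where
  open ≡-Reasoning
  b∸b%n≡[b/n]*n : b ∸ b % n ≡ (b / n) * n
  b∸b%n≡[b/n]*n = ≡.trans (cong (_∸ b % n) (m≡m%n+[m/n]*n b n)) (m+n∸m≡n (b % n) ((b / n) * n))

module _ {m : ℕ} where
  private
    n : ℕ
    n = suc m

  negate : Fin n → Fin n
  negate = μ zero

  -- Every reflection is an involution: (c - (c - i) mod n) ≡ i (mod n) with c = k + n.
  μ-involutive : ∀ k i → μ k (μ k i) ≡ i
  μ-involutive k i = toℕ-injective (begin
    toℕ (μ k (μ k i))           ≡⟨ toℕ-mod (c ∸ toℕ (μ k i)) n ⟩
    (c ∸ toℕ (μ k i)) % n       ≡⟨ cong (λ x → (c ∸ x) % n) (toℕ-mod (c ∸ toℕ i) n) ⟩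
    (c ∸ (c ∸ toℕ i) % n) % n   ≡⟨ [a∸b%n]%n≡[a∸b]%n c (c ∸ toℕ i) n (m∸n≤m c (toℕ i)) ⟩
    (c ∸ (c ∸ toℕ i)) % n       ≡⟨ cong (_% n) (m∸[m∸n]≡n i≤c) ⟩
    toℕ i % n                   ≡⟨ m<n⇒m%n≡m (toℕ<n i) ⟩
    toℕ i                       ∎)
    where
    open ≡-Reasoning
    c : ℕ
    c = toℕ k + n
    i≤c : toℕ i ≤ c
    i≤c = ≤-trans (<⇒≤ (toℕ<n i)) (m≤n+m n (toℕ k))

  -- Rotating by k and then by -k is the identity: (i + k) + (n - k) ≡ i (mod n).
  ρ-negate-ρ : ∀ k i → ρ (negate k) (ρ k i) ≡ i
  ρ-negate-ρ k i = toℕ-injective (begin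
    toℕ (ρ (negate k) (ρ k i))                       ≡⟨ toℕ-mod (toℕ (ρ k i) + toℕ (negate k)) n ⟩
    (toℕ (ρ k i) + toℕ (negate k)) % n               ≡⟨ cong₂ (λ x y → (x + y) % n) (toℕ-mod (toℕ i + toℕ k) n) (toℕ-mod (n ∸ toℕ k) n) ⟩
    ((toℕ i + toℕ k) % n + (n ∸ toℕ k) % n) % n      ≡⟨ ≡.sym (%-distribˡ-+ (toℕ i + toℕ k) (n ∸ toℕ k) n) ⟩
    (toℕ i + toℕ k + (n ∸ toℕ k)) % n                ≡⟨ cong (_% n) (+-assoc (toℕ i) (toℕ k) (n ∸ toℕ k)) ⟩
    (toℕ i + (toℕ k + (n ∸ toℕ k))) % n              ≡⟨ cong (λ x → (toℕ i + x) % n) (m+[n∸m]≡n (<⇒≤ (toℕ<n k))) ⟩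
    (toℕ i + n) % n                                  ≡⟨ [m+n]%n≡m%n (toℕ i) n ⟩
    toℕ i % n                                        ≡⟨ m<n⇒m%n≡m (toℕ<n i) ⟩
    toℕ i                                            ∎)
    where open ≡-Reasoning

  -- The other composite, obtained from the first since negate is an involution.
  ρ-ρ-negate : ∀ k i → ρ k (ρ (negate k) i) ≡ i
  ρ-ρ-negate k i = ≡.trans (cong (λ k′ → ρ k′ (ρ (negate k) i)) (≡.sym (μ-involutive zero k)))
                         (ρ-negate-ρ (negate k) i)

  rotation : Fin n → Permutation n n
  rotation k = permutation (ρ k) (ρ (negate k)) (ρ-ρ-negate k) (ρ-negate-ρ k)

  reflection : Fin n → Permutation n n
  reflection k = permutation (μ k) (μ k) (μ-involutive k) (μ-involutive k)

  negation : Permutation n n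
  negation = permutation negate negate (μ-involutive zero) (μ-involutive zero)

module _ {c ℓ} (R : CommutativeRing c ℓ) where
  open CommutativeRing R
    using (Carrier; _≈_; sym; trans; reflexive; +-commutativeMonoid; *-commutativeMonoid)
    renaming (_+_ to _+ᴿ_; _*_ to _*ᴿ_)
  private
    module ∑ = MonoidSum +-commutativeMonoid
    module ∏ = MonoidSum *-commutativeMonoid

  Σ≡∑ : ∀ n (f : Fin n → Carrier) → Σ[_] R n f ≡ ∑.sum f
  Σ≡∑ zero    f = refl
  Σ≡∑ (suc n) f = cong (f zero +ᴿ_) (Σ≡∑ n (λ i → f (suc i)))

  Π≡∏ : ∀ n (f : Fin n → Carrier) → Π[_] R n f ≡ ∏.sum f
  Π≡∏ zero    f = refl
  Π≡∏ (suc n) f = cong (f zero *ᴿ_) (Π≡∏ n (λ i → f (suc i)))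

  ∑∏ : ∀ {n} → Matrix R n → (Fin n → Fin n → Fin n) → Carrier
  ∑∏ {n} A p = ∑.sum (λ k → ∏.sum (λ i → A i (p k i)))

  Σ[Π]≡∑∏ : ∀ {n} (A : Matrix R n) (p : Fin n → Fin n → Fin n) →
    Σ[_] R n (λ k → Π[_] R n (λ i → A i (p k i))) ≡ ∑∏ A p
  Σ[Π]≡∑∏ {n} A p = ≡.trans (Σ≡∑ n _) (∑.sum-cong-≗ (λ k → Π≡∏ n (λ i → A i (p k i))))

  ∏-transpose : ∀ {n} (A : Matrix R n) (π : Permutation n n) →
    ∏.sum (λ i → A (π ⟨$⟩ʳ i) i) ≈ ∏.sum (λ j → A j (π ⟨$⟩ˡ j))
  ∏-transpose A π =
    sym (trans (∏.sum-permute (λ j → A j (π ⟨$⟩ˡ j)) π)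
               (reflexive (∏.sum-cong-≗ (λ i → cong (A (π ⟨$⟩ʳ i)) (inverseˡ π)))))

  -- For a family of permutations closed under inversion along a reindexing φ
  -- (the (φ k)-th member is the inverse of the k-th), the sum of the products
  -- along the family is the same for Aᵀ and for A.
  ∑∏-transpose : ∀ {n} (A : Matrix R n) (π : Fin n → Permutation n n) (φ : Permutation n n) →
    (∀ k i → π (φ ⟨$⟩ʳ k) ⟨$⟩ʳ i ≡ π k ⟨$⟩ˡ i) →
    ∑∏ (transpose R A) (λ k → π k ⟨$⟩ʳ_) ≈ ∑∏ A (λ k → π k ⟨$⟩ʳ_)
  ∑∏-transpose A π φ closed = begin
    ∑.sum (λ k → ∏.sum (λ i → A (π k ⟨$⟩ʳ i) i))     ≈⟨ ∑.sum-cong-≋ (λ k → ∏-transpose A (π k)) ⟩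
    ∑.sum (λ k → ∏.sum (λ j → A j (π k ⟨$⟩ˡ j)))     ≡⟨ ∑.sum-cong-≗ (λ k → ∏.sum-cong-≗ (λ j → cong (A j) (closed k j))) ⟨
    ∑.sum (λ k → ∏.sum (λ j → A j (π (φ ⟨$⟩ʳ k) ⟨$⟩ʳ j)))  ≈⟨ ∑.sum-permute (λ k → ∏.sum (λ j → A j (π k ⟨$⟩ʳ j))) φ ⟨
    ∑.sum (λ k → ∏.sum (λ j → A j (π k ⟨$⟩ʳ j)))     ∎
    where open import Relation.Binary.Reasoning.Setoid (CommutativeRing.setoid R)

theorem1 : ∀ {c ℓ} (R : CommutativeRing c ℓ) (m : ℕ) (A : Matrix R (suc m)) →
    CommutativeRing._≈_ R (dih R (transpose R A)) (dih R A)
theorem1 R m A = begin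
  dih R (transpose R A)                      ≡⟨ cong₂ _-_ (Σ[Π]≡∑∏ R (transpose R A) ρ) (Σ[Π]≡∑∏ R (transpose R A) μ) ⟩
  ∑∏ R (transpose R A) ρ - ∑∏ R (transpose R A) μ
    ≈⟨ +-cong (∑∏-transpose R A rotation negation (λ k i → refl))
              (-‿cong (∑∏-transpose R A reflection Perm.id (λ k i → refl))) ⟩
  ∑∏ R A ρ - ∑∏ R A μ                        ≡⟨ cong₂ _-_ (Σ[Π]≡∑∏ R A ρ) (Σ[Π]≡∑∏ R A μ) ⟨
  dih R A                                    ∎
  where
  open CommutativeRing R using (_-_; +-cong; -‿cong)
  open import Relation.Binary.Reasoning.Setoid (CommutativeRing.setoid R)
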